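{- Let $\Sigma$ be a totally ordered alphabet with $\sigma$ letters, let $p\geq 1$, and let $w=a_1\cdots a_n\in\Sigma^n$ with $n=pq+r$, where $q\geq 1$ and $0\leq r<p$ are integers. Let $A=\{\!\{w_1,\dots,w_q\}\!\}$, where $w_i=a_{(i-1)p+1}\cdots a_{ip}$ for $1\leq i\leq q-1$ and $w_q=a_{(q-1)p+1}\cdots a_{pq+r}$ (so $A$ is a $(p-1)$-restricted decomposition of $w$, i.e. $w=w_1\cdots w_q$ and every $|w_i|\geq p$). Then $\rho(A)\leq\sigma^p+2(p+r)$.
   Context: For a string $x=x_1\cdots x_n$, $\texttt{runs}(x)=\sum_{i=1}^{n-1}\mathbf{1}_{x_i\neq x_{i+1}}$. Every string $u$ can be written uniquely as $u=v^e$ with $v$ primitive; write $\mathrm{root}(u)=v$, $\exp(u)=e$. The $\omega$-order: $u\preceq_\omega v$ iff either $\mathrm{root}(u)=\mathrm{root}(v)$ and $\exp(u)\leq\exp(v)$, or $\mathrm{root}(u)\neq\mathrm{root}(v)$ and $u^\omega<_{\mathrm{lex}}v^\omega$. For a multiset $W$ of nonempty strings, $\texttt{ebwt}(W)$ is obtained by listing all circular rotations of all strings of $W$ (one per position of each string, with multiplicity), sorting them in ascending $\omega$-order, and concatenating their last characters. $\rho(W)=\texttt{runs}(\texttt{ebwt}(W))$. -}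

module Defs where

open import Data.Nat using (ℕ; zero; suc; _+_; _*_; _≤_; _<_; _^_)
open import Data.Nat.DivMod using (_mod_)
open import Data.Fin as Fin using (Fin)
open import Data.List using (List; []; _∷_; _++_; take; drop; length; map; concatMap; upTo; mapMaybe; last)
open import Data.List.Relation.Unary.Linked using (Linked)
open import Data.List.Relation.Binary.Permutation.Propositional using (_↭_)
open import Data.Product using (Σ; ∃; _×_; _,_)
open import Data.Sum using (_⊎_)
open import Relation.Nullary using (¬_; yes; no)
open import Relation.Binary.PropositionalEquality using (_≡_)
open import Data.Empty using (⊥)

-- A totally ordered alphabet with σ letters is (up to order isomorphism)
-- Fin σ with its natural order.
Word : ℕ → Set
Word σ = List (Fin σ)

module _ {σ : ℕ} where

  diff : Fin σ → Fin σ → ℕ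
  diff x y with x Fin.≟ y
  ... | yes _ = 0
  ... | no  _ = 1

  runs : Word σ → ℕ
  runs [] = 0
  runs (x ∷ []) = 0
  runs (x ∷ y ∷ xs) = diff x y + runs (y ∷ xs)

  pow : Word σ → ℕ → Word σ
  pow u zero = []
  pow u (suc e) = u ++ pow u e

  Primitive : Word σ → Set
  Primitive v = ¬ (v ≡ []) × ¬ (Σ (Word σ) λ z → Σ ℕ λ k → (2 ≤ k) × (v ≡ pow z k))

  SameRoot : Word σ → Word σ → Set
  SameRoot u v = Σ (Word σ) λ r → Σ ℕ λ e → Σ ℕ λ f → Primitive r × (u ≡ pow r e) × (v ≡ pow r f)

  omegaAt : Fin σ → Word σ → ℕ → Fin σ
  omegaAt x xs i = Data.List.lookup (x ∷ xs) (i mod suc (length xs))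

  -- strict lexicographic order on infinite words u^ω <lex v^ω
  -- (only meaningful for nonempty u, v; empty words never occur below)
  _<ωlex_ : Word σ → Word σ → Set
  [] <ωlex _ = ⊥
  (_ ∷ _) <ωlex [] = ⊥
  (x ∷ xs) <ωlex (y ∷ ys) =
    Σ ℕ λ k → ((i : ℕ) → i < k → omegaAt x xs i ≡ omegaAt y ys i)
              × (omegaAt x xs k Fin.< omegaAt y ys k)

  _⪯ω_ : Word σ → Word σ → Set
  u ⪯ω v = (Σ (Word σ) λ r → Σ ℕ λ e → Σ ℕ λ f →
               Primitive r × (u ≡ pow r e) × (v ≡ pow r f) × (e ≤ f))
           ⊎ ((¬ SameRoot u v) × (u <ωlex v))

  rotations : Word σ → List (Word σ)
  rotations w = map (λ i → drop i w ++ take i w) (upTo (length w))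

  allRotations : List (Word σ) → List (Word σ)
  allRotations W = concatMap rotations W

  lastChars : List (Word σ) → Word σ
  lastChars = mapMaybe last

  IsEBWT : List (Word σ) → Word σ → Set
  IsEBWT W L = Σ (List (Word σ)) λ R → (R ↭ allRotations W) × Linked _⪯ω_ R × (L ≡ lastChars R)

  blocks : ℕ → ℕ → Word σ → List (Word σ)
  blocks p zero w = []
  blocks p (suc zero) w = w ∷ []
  blocks p (suc (suc k)) w = take p w ∷ blocks p (suc k) (drop p w)

{-# OPTIONS --safe #-}
-- Give each rotation u the number c(u) < σ ^ p whose base-σ digits are the first p
-- letters of u^ω. Along the ω-sorted list of rotations this code never decreases, and two
-- adjacent rotations of length p with the same code are equal, hence have the same last letter.
-- So every run boundary of the ebwt either raises the code, which happens fewer than σ ^ p times,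
-- or sits next to a rotation whose length is not p. Only the p + r rotations of the last block
-- can have length other than p, and each of them sits next to at most two boundaries.
module Submission where

open import Defs
open import Data.Nat using (ℕ; _+_; _*_; _≤_; _<_; _^_)
open import Data.List using (length)
open import Relation.Binary.PropositionalEquality using (_≡_)

open import Data.Nat using (zero; suc; _∸_; _⊓_; _%_; NonZero; z≤n; z<s; s<s; s<s⁻¹; _≟_; _<?_)
open import Data.Nat.Properties
open import Data.Nat.DivMod using (_mod_; m%n<n; m<n⇒m%n≡m; m≤n⇒[n∸m]%m≡n%m; m∣n⇒o%n%m≡o%m)
open import Data.Nat.Divisibility using (divides)
open import Data.Nat.ListAction using (sum)
open import Data.Nat.ListAction.Properties using (sum-++; sum-↭)
open import Data.Nat.Tactic.RingSolver using (solve-∀)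
open import Data.Fin as Fin using (Fin; toℕ)
open import Data.Fin.Properties using (toℕ<n; toℕ-injective; toℕ-fromℕ<)
open import Data.List using (List; []; _∷_; _++_; [_]; _?∷_; take; drop; map; upTo; last; lookup)
open import Data.List.Properties
  using ( length-map; length-upTo; length-take; length-drop; length-++; length-++-comm
        ; take++drop≡id; ++-identityʳ; map-++; ≡-dec )
open import Data.List.Relation.Unary.All as All using (All; []; _∷_)
open import Data.List.Relation.Unary.All.Properties using (++⁺) renaming (map⁺ to All-map⁺)
open import Data.List.Relation.Unary.Linked using (Linked; []; [-]; _∷_)
open import Data.List.Relation.Binary.Permutation.Propositional using (↭-sym)
open import Data.List.Relation.Binary.Permutation.Propositional.Properties
  using (All-resp-↭) renaming (map⁺ to ↭-map⁺)
open import Data.Maybe using (Maybe; just; nothing)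
open import Data.Maybe.Properties using (just-injective)
open import Data.Product using (_×_; _,_)
open import Data.Sum using (inj₁; inj₂)
open import Function using (_∘_)
open import Relation.Binary using (Rel; tri<; tri≈; tri>)
open import Relation.Binary.PropositionalEquality
  using (_≢_; refl; sym; trans; cong; cong₂; subst; module ≡-Reasoning)
open import Relation.Nullary using (yes; no; contradiction)

digit-< : ∀ {a b x y B} → x < B → a < b → a * B + x < b * B + y
digit-< {a} {b} {x} {y} {B} x<B a<b = begin-strict
  a * B + x  <⟨ +-monoʳ-< (a * B) x<B ⟩
  a * B + B  ≡⟨ +-comm (a * B) B ⟩
  suc a * B  ≤⟨ *-monoˡ-≤ B a<b ⟩
  b * B      ≤⟨ m≤m+n (b * B) y ⟩
  b * B + y  ∎
  where open ≤-Reasoning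

digit-injective : ∀ {a b x y B} → x < B → y < B → a * B + x ≡ b * B + y → a ≡ b × x ≡ y
digit-injective {a} {b} {x} {y} {B} x<B y<B eq with <-cmp a b
... | tri< a<b _ _  = contradiction eq (<⇒≢ (digit-< x<B a<b))
... | tri> _ _ b<a  = contradiction (sym eq) (<⇒≢ (digit-< y<B b<a))
... | tri≈ _ refl _ = refl , +-cancelˡ-≡ (a * B) x y eq

module _ {a} {A : Set a} where

  lookupMaybe : List A → ℕ → Maybe A
  lookupMaybe []       _       = nothing
  lookupMaybe (x ∷ xs) zero    = just x
  lookupMaybe (x ∷ xs) (suc i) = lookupMaybe xs i

  lookupMaybe-lookup : ∀ (xs : List A) i → lookupMaybe xs (toℕ i) ≡ just (lookup xs i)
  lookupMaybe-lookup (x ∷ xs) Fin.zero    = refl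
  lookupMaybe-lookup (x ∷ xs) (Fin.suc i) = lookupMaybe-lookup xs i

  lookupMaybe-++ˡ : ∀ (xs ys : List A) {i} → i < length xs → lookupMaybe (xs ++ ys) i ≡ lookupMaybe xs i
  lookupMaybe-++ˡ (x ∷ xs) ys {zero}  _   = refl
  lookupMaybe-++ˡ (x ∷ xs) ys {suc i} i<n = lookupMaybe-++ˡ xs ys (s<s⁻¹ i<n)

  lookupMaybe-++ʳ : ∀ (xs ys : List A) i → lookupMaybe (xs ++ ys) (length xs + i) ≡ lookupMaybe ys i
  lookupMaybe-++ʳ []       ys i = refl
  lookupMaybe-++ʳ (x ∷ xs) ys i = lookupMaybe-++ʳ xs ys i

  lookupMaybe-ext : ∀ {xs ys : List A} → length xs ≡ length ys →
                    (∀ i → i < length xs → lookupMaybe xs i ≡ lookupMaybe ys i) → xs ≡ ys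
  lookupMaybe-ext {[]}     {[]}     _  _     = refl
  lookupMaybe-ext {x ∷ xs} {y ∷ ys} eq agree =
    cong₂ _∷_ (just-injective (agree 0 z<s))
              (lookupMaybe-ext (suc-injective eq) (λ i → agree (suc i) ∘ s<s))

  length-take-≡ : ∀ m (xs : List A) {n} → length xs ≡ m + n → length (take m xs) ≡ m
  length-take-≡ m xs {n} eq =
    trans (length-take m xs) (trans (cong (m ⊓_) eq) (m≤n⇒m⊓n≡m (m≤m+n m n)))

  length-drop-≡ : ∀ m (xs : List A) {n} → length xs ≡ m + n → length (drop m xs) ≡ n
  length-drop-≡ m xs {n} eq =
    trans (length-drop m xs) (trans (cong (_∸ m) eq) (m+n∸m≡n m n))

  length-rotation : ∀ (xs : List A) i → length (drop i xs ++ take i xs) ≡ length xs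
  length-rotation xs i =
    trans (length-++-comm (drop i xs) (take i xs)) (cong length (take++drop≡id i xs))

  pairwiseSum : (A → A → ℕ) → List A → ℕ
  pairwiseSum c []           = 0
  pairwiseSum c (x ∷ [])     = 0
  pairwiseSum c (x ∷ y ∷ xs) = c x y + pairwiseSum c (y ∷ xs)

module _ {a ℓ} {A : Set a} {_∼_ : Rel A ℓ} (c : A → A → ℕ) (φ w : A → ℕ) {B : ℕ}
         (φ≤B : ∀ x → φ x ≤ B) (step : ∀ {x y} → x ∼ y → c x y + φ x ≤ w x + w y + φ y) where

  private
    invariant : ∀ {x xs} → Linked _∼_ (x ∷ xs) →
                pairwiseSum c (x ∷ xs) + φ x + w x ≤ B + 2 * sum (map w (x ∷ xs))
    invariant {x} [-] = +-mono-≤ (φ≤B x) (≤-trans (m≤m+n (w x) 0) (m≤n*m (w x + 0) 2))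
    invariant {x} {y ∷ xs} (x∼y ∷ linked) = begin
      (c x y + P) + φ x + w x      ≡⟨ shuffle₁ (c x y) P (φ x) (w x) ⟩
      P + (c x y + φ x) + w x      ≤⟨ +-monoˡ-≤ (w x) (+-monoʳ-≤ P (step x∼y)) ⟩
      P + (w x + w y + φ y) + w x  ≡⟨ shuffle₂ P (w x) (w y) (φ y) ⟩
      (P + φ y + w y) + 2 * w x    ≤⟨ +-monoˡ-≤ (2 * w x) (invariant linked) ⟩
      B + 2 * S + 2 * w x          ≡⟨ shuffle₃ B S (w x) ⟩
      B + 2 * (w x + S)            ∎
      where
        open ≤-Reasoning
        P = pairwiseSum c (y ∷ xs)
        S = sum (map w (y ∷ xs))
        shuffle₁ : ∀ c P φ w → (c + P) + φ + w ≡ P + (c + φ) + w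
        shuffle₁ = solve-∀
        shuffle₂ : ∀ P wx wy φ → P + (wx + wy + φ) + wx ≡ (P + φ + wy) + 2 * wx
        shuffle₂ = solve-∀
        shuffle₃ : ∀ B S w → B + 2 * S + 2 * w ≡ B + 2 * (w + S)
        shuffle₃ = solve-∀

  pairwiseSum-≤-potential : ∀ {xs} → Linked _∼_ xs → pairwiseSum c xs ≤ B + 2 * sum (map w xs)
  pairwiseSum-≤-potential []                = z≤n
  pairwiseSum-≤-potential {x ∷ xs} linked =
    ≤-trans (≤-trans (m≤m+n _ (φ x)) (m≤m+n _ (w x))) (invariant linked)

module _ {σ : ℕ} where

  length-pow : ∀ (u : Word σ) e → length (pow u e) ≡ e * length u
  length-pow u zero    = refl
  length-pow u (suc e) = trans (length-++ u) (cong (length u +_) (length-pow u e))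

  lookupMaybe-pow : ∀ (u : Word σ) .{{_ : NonZero (length u)}} e {j} → j < e * length u →
                    lookupMaybe (pow u e) j ≡ lookupMaybe u (j % length u)
  lookupMaybe-pow u (suc e) {j} j<U with j <? length u
  ... | yes j<M = trans (lookupMaybe-++ˡ u (pow u e) j<M) (cong (lookupMaybe u) (sym (m<n⇒m%n≡m j<M)))
  ... | no  j≮M = begin
    lookupMaybe (u ++ pow u e) j        ≡⟨ cong (lookupMaybe (u ++ pow u e)) (sym M+k≡j) ⟩
    lookupMaybe (u ++ pow u e) (M + k)  ≡⟨ lookupMaybe-++ʳ u (pow u e) k ⟩
    lookupMaybe (pow u e) k             ≡⟨ lookupMaybe-pow u e k<eM ⟩
    lookupMaybe u (k % M)               ≡⟨ cong (lookupMaybe u) (m≤n⇒[n∸m]%m≡n%m M≤j) ⟩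
    lookupMaybe u (j % M)               ∎
    where
      open ≡-Reasoning
      M = length u
      k = j ∸ M
      M≤j = ≮⇒≥ j≮M
      M+k≡j : M + k ≡ j
      M+k≡j = m+[n∸m]≡n M≤j
      k<eM : k < e * M
      k<eM = +-cancelˡ-< M k (e * M) (subst (_< M + e * M) (sym M+k≡j) j<U)

  lookupMaybe-omegaAt : ∀ (x : Fin σ) xs i →
                        lookupMaybe (x ∷ xs) (i % length (x ∷ xs)) ≡ just (omegaAt x xs i)
  lookupMaybe-omegaAt x xs i =
    trans (cong (lookupMaybe u) (sym (toℕ-fromℕ< (m%n<n i (length u))))) (lookupMaybe-lookup u (i mod length u))
    where u = x ∷ xs

  lookupMaybe-omegaAt-< : ∀ (x : Fin σ) xs {i} → i < length (x ∷ xs) →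
                          lookupMaybe (x ∷ xs) i ≡ just (omegaAt x xs i)
  lookupMaybe-omegaAt-< x xs {i} i<n =
    trans (cong (lookupMaybe (x ∷ xs)) (sym (m<n⇒m%n≡m i<n))) (lookupMaybe-omegaAt x xs i)

  -- (r^(e+1))^ω = r^ω, where pow (y ∷ ys) (suc e) unfolds to y ∷ (ys ++ pow (y ∷ ys) e).
  omegaAt-pow : ∀ (y : Fin σ) ys e i → omegaAt y (ys ++ pow (y ∷ ys) e) i ≡ omegaAt y ys i
  omegaAt-pow y ys e i = just-injective (begin
    just (omegaAt y (ys ++ pow r e) i)   ≡⟨ sym (lookupMaybe-omegaAt y (ys ++ pow r e) i) ⟩
    lookupMaybe (pow r (suc e)) (i % U)  ≡⟨ lookupMaybe-pow r (suc e) i%U<U ⟩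
    lookupMaybe r (i % U % M)            ≡⟨ cong (lookupMaybe r) (m∣n⇒o%n%m≡o%m M U i M∣U) ⟩
    lookupMaybe r (i % M)                ≡⟨ lookupMaybe-omegaAt y ys i ⟩
    just (omegaAt y ys i)                ∎)
    where
      open ≡-Reasoning
      r = y ∷ ys
      M = length r
      U = length (pow r (suc e))
      U≡[1+e]M : U ≡ suc e * M
      U≡[1+e]M = length-pow r (suc e)
      M∣U = divides (suc e) U≡[1+e]M
      i%U<U = subst (i % U <_) U≡[1+e]M (m%n<n i U)

  lexCode : (ℕ → Fin σ) → ℕ → ℕ
  lexCode g zero    = 0
  lexCode g (suc m) = toℕ (g 0) * σ ^ m + lexCode (g ∘ suc) m

  lexCode-< : ∀ g m → lexCode g m < σ ^ m
  lexCode-< g zero    = z<s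
  lexCode-< g (suc m) =
    <-≤-trans (digit-< (lexCode-< (g ∘ suc) m) (toℕ<n (g 0))) (≤-reflexive (+-identityʳ (σ ^ suc m)))

  lexCode-cong : ∀ {g h} m → (∀ i → i < m → g i ≡ h i) → lexCode g m ≡ lexCode h m
  lexCode-cong zero    _     = refl
  lexCode-cong (suc m) agree =
    cong₂ (λ d rest → toℕ d * σ ^ m + rest) (agree 0 z<s) (lexCode-cong m (λ i → agree (suc i) ∘ s<s))

  lexCode-strict : ∀ {g h k} m → k < m → (∀ i → i < k → g i ≡ h i) → g k Fin.< h k →
                   lexCode g m < lexCode h m
  lexCode-strict {k = zero} (suc m) _ _ g₀<h₀ = digit-< (lexCode-< _ m) g₀<h₀
  lexCode-strict {g} {h} {suc k} (suc m) k<m agree gₖ<hₖ rewrite agree 0 z<s =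
    +-monoʳ-< (toℕ (h 0) * σ ^ m) (lexCode-strict m (s<s⁻¹ k<m) (λ i → agree (suc i) ∘ s<s) gₖ<hₖ)

  lexCode-injective : ∀ {g h} m → lexCode g m ≡ lexCode h m → ∀ i → i < m → g i ≡ h i
  lexCode-injective {g} {h} (suc m) eq i i<m
    with digit-injective {toℕ (g 0)} {toℕ (h 0)} (lexCode-< (g ∘ suc) m) (lexCode-< (h ∘ suc) m) eq
  lexCode-injective (suc m) eq zero    _   | g₀≡h₀ , _     = toℕ-injective g₀≡h₀
  lexCode-injective (suc m) eq (suc i) i<m | _     , tail≡ = lexCode-injective m tail≡ i (s<s⁻¹ i<m)

  boundary : Word σ → Word σ → ℕ
  boundary u v = runs (lastChars (u ∷ v ∷ []))

  diff-refl : ∀ (a : Fin σ) → diff a a ≡ 0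
  diff-refl a with a Fin.≟ a
  ... | yes _   = refl
  ... | no  a≢a = contradiction refl a≢a

  diff≤1 : ∀ (a b : Fin σ) → diff a b ≤ 1
  diff≤1 a b with a Fin.≟ b
  ... | yes _ = z≤n
  ... | no  _ = ≤-refl

  boundary-refl : ∀ u → boundary u u ≡ 0
  boundary-refl u with last u
  ... | nothing = refl
  ... | just a  = cong (_+ 0) (diff-refl a)

  boundary≤1 : ∀ u v → boundary u v ≤ 1
  boundary≤1 u v with last u | last v
  ... | nothing | nothing = z≤n
  ... | nothing | just _  = z≤n
  ... | just _  | nothing = z≤n
  ... | just a  | just b  = ≤-trans (≤-reflexive (+-identityʳ (diff a b))) (diff≤1 a b)

  last≡nothing⇒[] : ∀ (u : Word σ) → last u ≡ nothing → u ≡ []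
  last≡nothing⇒[] []           _  = refl
  last≡nothing⇒[] (x ∷ [])     ()
  last≡nothing⇒[] (x ∷ y ∷ xs) eq with () ← last≡nothing⇒[] (y ∷ xs) eq

  runs-?∷ : ∀ m (b : Fin σ) bs → runs (m ?∷ (b ∷ bs)) ≡ runs (m ?∷ [ b ]) + runs (b ∷ bs)
  runs-?∷ nothing  b bs = refl
  runs-?∷ (just a) b bs = cong (_+ runs (b ∷ bs)) (sym (+-identityʳ (diff a b)))

  runs-lastChars : ∀ {R : List (Word σ)} → All (_≢ []) R → runs (lastChars R) ≡ pairwiseSum boundary R
  runs-lastChars {[]}     _ = refl
  runs-lastChars {u ∷ []} _ with last u
  ... | nothing = refl
  ... | just _  = refl
  runs-lastChars {u ∷ v ∷ R} (_ ∷ v≢[] ∷ nonempty)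
    with last v in last-v | runs-lastChars (v≢[] ∷ nonempty)
  ... | nothing | _  = contradiction (last≡nothing⇒[] v last-v) v≢[]
  ... | just b  | IH = trans (runs-?∷ (last u) b (lastChars R)) (cong (runs (last u ?∷ [ b ]) +_) IH)

  rotations-length : ∀ (u : Word σ) → All (λ v → length v ≡ length u) (rotations u)
  rotations-length u = All-map⁺ (All.universal (length-rotation u) _)

  length-rotations : ∀ (u : Word σ) → length (rotations u) ≡ length u
  length-rotations u = trans (length-map _ (upTo (length u))) (length-upTo (length u))

module _ {σ : ℕ} (p : ℕ) where

  prefixCode : Word σ → ℕ
  prefixCode []       = 0
  prefixCode (x ∷ xs) = lexCode (omegaAt x xs) p

  prefixCode-≤ : ∀ u → prefixCode u ≤ σ ^ p
  prefixCode-≤ []       = z≤n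
  prefixCode-≤ (x ∷ xs) = <⇒≤ (lexCode-< (omegaAt x xs) p)

  prefixCode-pow : ∀ (u : Word σ) e → prefixCode (pow u (suc e)) ≡ prefixCode u
  prefixCode-pow []       zero    = refl
  prefixCode-pow []       (suc e) = prefixCode-pow [] e
  prefixCode-pow (y ∷ ys) e       = lexCode-cong p (λ i _ → omegaAt-pow y ys e i)

  prefixCode-mono : ∀ {u v : Word σ} → u ⪯ω v → prefixCode u ≤ prefixCode v
  prefixCode-mono (inj₁ (r , zero  , _     , _ , refl , refl , _)) = z≤n
  prefixCode-mono (inj₁ (r , suc e , zero  , _ , _    , _    , ()))
  prefixCode-mono (inj₁ (r , suc e , suc f , _ , refl , refl , _)) =
    ≤-reflexive (trans (prefixCode-pow r e) (sym (prefixCode-pow r f)))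
  prefixCode-mono {[]}              (inj₂ (_ , ()))
  prefixCode-mono {_ ∷ _}  {[]}     (inj₂ (_ , ()))
  prefixCode-mono {x ∷ xs} {y ∷ ys} (inj₂ (_ , k , agree , xₖ<yₖ)) with k <? p
  ... | yes k<p = <⇒≤ (lexCode-strict p k<p agree xₖ<yₖ)
  ... | no  k≮p = ≤-reflexive (lexCode-cong p (λ i i<p → agree i (<-≤-trans i<p (≮⇒≥ k≮p))))

  prefixCode-injective : ∀ {u v : Word σ} → length u ≡ p → length v ≡ p →
                         prefixCode u ≡ prefixCode v → u ≡ v
  prefixCode-injective {[]}     {[]}     _     _     _  = refl
  prefixCode-injective {[]}     {_ ∷ _}  ∣u∣≡p ∣v∣≡p _ =
    contradiction (trans ∣u∣≡p (sym ∣v∣≡p)) 0≢1+n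
  prefixCode-injective {_ ∷ _}  {[]}     ∣u∣≡p ∣v∣≡p _ =
    contradiction (trans ∣v∣≡p (sym ∣u∣≡p)) 0≢1+n
  prefixCode-injective {x ∷ xs} {y ∷ ys} ∣u∣≡p ∣v∣≡p eq =
    lookupMaybe-ext ∣u∣≡∣v∣ λ i i<∣u∣ → begin
      lookupMaybe (x ∷ xs) i  ≡⟨ lookupMaybe-omegaAt-< x xs i<∣u∣ ⟩
      just (omegaAt x xs i)   ≡⟨ cong just (lexCode-injective p eq i (subst (i <_) ∣u∣≡p i<∣u∣)) ⟩
      just (omegaAt y ys i)   ≡⟨ sym (lookupMaybe-omegaAt-< y ys (subst (i <_) ∣u∣≡∣v∣ i<∣u∣)) ⟩
      lookupMaybe (y ∷ ys) i  ∎
    where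
      open ≡-Reasoning
      ∣u∣≡∣v∣ = trans ∣u∣≡p (sym ∣v∣≡p)

  offLength : Word σ → ℕ
  offLength u with length u ≟ p
  ... | yes _ = 0
  ... | no  _ = 1

  offLength-regular : ∀ {u} → length u ≡ p → offLength u ≡ 0
  offLength-regular {u} ∣u∣≡p with length u ≟ p
  ... | yes _     = refl
  ... | no  ∣u∣≢p = contradiction ∣u∣≡p ∣u∣≢p

  offLength≤1 : ∀ u → offLength u ≤ 1
  offLength≤1 u with length u ≟ p
  ... | yes _ = z≤n
  ... | no  _ = ≤-refl

  boundary+prefixCode-≤ : ∀ {u v} → u ⪯ω v → boundary u v + prefixCode u ≤ 1 + prefixCode v
  boundary+prefixCode-≤ {u} {v} u⪯v = +-mono-≤ (boundary≤1 u v) (prefixCode-mono u⪯v)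

  boundary+prefixCode-≤-regular : ∀ {u v} → length u ≡ p → length v ≡ p → u ⪯ω v →
                                  boundary u v + prefixCode u ≤ prefixCode v
  boundary+prefixCode-≤-regular {u} {v} ∣u∣≡p ∣v∣≡p u⪯v with ≡-dec Fin._≟_ u v
  ... | yes refl = ≤-reflexive (cong (_+ prefixCode u) (boundary-refl u))
  ... | no  u≢v  = ≤-trans (+-monoˡ-≤ (prefixCode u) (boundary≤1 u v))
                     (≤∧≢⇒< (prefixCode-mono u⪯v) (u≢v ∘ prefixCode-injective ∣u∣≡p ∣v∣≡p))

  boundary-step : ∀ {u v} → u ⪯ω v →
                  boundary u v + prefixCode u ≤ offLength u + offLength v + prefixCode v
  boundary-step {u} {v} u⪯v with length u ≟ p | length v ≟ p
  ... | yes ∣u∣≡p | yes ∣v∣≡p = boundary+prefixCode-≤-regular ∣u∣≡p ∣v∣≡p u⪯v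
  ... | yes _     | no  _     = boundary+prefixCode-≤ u⪯v
  ... | no  _     | yes _     = boundary+prefixCode-≤ u⪯v
  ... | no  _     | no  _     = ≤-trans (boundary+prefixCode-≤ u⪯v) (n≤1+n _)

  sum-offLength-regular : ∀ {vs} → All (λ v → length v ≡ p) vs → sum (map offLength vs) ≡ 0
  sum-offLength-regular []                = refl
  sum-offLength-regular (∣v∣≡p ∷ regular) =
    cong₂ _+_ (offLength-regular ∣v∣≡p) (sum-offLength-regular regular)

  sum-offLength-≤ : ∀ vs → sum (map offLength vs) ≤ length vs
  sum-offLength-≤ []       = z≤n
  sum-offLength-≤ (v ∷ vs) = +-mono-≤ (offLength≤1 v) (sum-offLength-≤ vs)

  allRotations-long : ∀ {B : List (Word σ)} → All (λ b → p ≤ length b) B →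
                      All (λ v → p ≤ length v) (allRotations B)
  allRotations-long []                     = []
  allRotations-long {b ∷ _} (p≤∣b∣ ∷ long) =
    ++⁺ (All.map (λ ∣v∣≡∣b∣ → subst (p ≤_) (sym ∣v∣≡∣b∣) p≤∣b∣) (rotations-length b))
        (allRotations-long long)

  length-split : ∀ q r → p * suc q + r ≡ p + (p * q + r)
  length-split q r = trans (cong (_+ r) (*-suc p q)) (+-assoc p (p * q) r)

  blocks-long : ∀ {r} q {w : Word σ} → length w ≡ p * q + r →
                All (λ b → p ≤ length b) (blocks p q w)
  blocks-long zero                     _   = []
  blocks-long {r} (suc zero)           ∣w∣ =
    ≤-trans (m≤m+n p r) (≤-reflexive (sym (trans ∣w∣ (cong (_+ r) (*-identityʳ p))))) ∷ []
  blocks-long {r} (suc (suc q)) {w}    ∣w∣ =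
    ≤-reflexive (sym (length-take-≡ p w ∣w∣′)) ∷ blocks-long (suc q) (length-drop-≡ p w ∣w∣′)
    where ∣w∣′ = trans ∣w∣ (length-split (suc q) r)

  offLength-blocks : ∀ {r} q {w : Word σ} → length w ≡ p * q + r →
                     sum (map offLength (allRotations (blocks p q w))) ≤ p + r
  offLength-blocks zero                   _   = z≤n
  offLength-blocks {r} (suc zero) {w}     ∣w∣ = begin
    sum (map offLength (rotations w ++ []))  ≤⟨ sum-offLength-≤ (rotations w ++ []) ⟩
    length (rotations w ++ [])               ≡⟨ cong length (++-identityʳ (rotations w)) ⟩
    length (rotations w)                     ≡⟨ length-rotations w ⟩
    length w                                 ≡⟨ trans ∣w∣ (cong (_+ r) (*-identityʳ p)) ⟩
    p + r                                    ∎
    where open ≤-Reasoning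
  offLength-blocks {r} (suc (suc q)) {w}  ∣w∣ = begin
    sum (map offLength (rotations t ++ rest))
      ≡⟨ cong sum (map-++ offLength (rotations t) rest) ⟩
    sum (map offLength (rotations t) ++ map offLength rest)
      ≡⟨ sum-++ (map offLength (rotations t)) (map offLength rest) ⟩
    sum (map offLength (rotations t)) + sum (map offLength rest)
      ≡⟨ cong (_+ sum (map offLength rest)) t-regular ⟩
    sum (map offLength rest)
      ≤⟨ offLength-blocks (suc q) (length-drop-≡ p w ∣w∣′) ⟩
    p + r
      ∎
    where
      open ≤-Reasoning
      ∣w∣′ = trans ∣w∣ (length-split (suc q) r)
      t = take p w
      rest = allRotations (blocks p (suc q) (drop p w))
      t-regular : sum (map offLength (rotations t)) ≡ 0
      t-regular =
        sum-offLength-regular (All.map (λ e → trans e (length-take-≡ p w ∣w∣′)) (rotations-length t))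

proposition4 : (σ p q r : ℕ) → 1 ≤ p → 1 ≤ q → r < p →
    (w : Word σ) → length w ≡ p * q + r →
    (L : Word σ) → IsEBWT (blocks p q w) L →
    runs L ≤ σ ^ p + 2 * (p + r)
proposition4 σ p q r 1≤p _ _ w ∣w∣ L (R , R↭rotations , sorted , refl) = begin
  runs (lastChars R)
    ≡⟨ runs-lastChars (All-resp-↭ (↭-sym R↭rotations) (All.map nonempty long)) ⟩
  pairwiseSum boundary R
    ≤⟨ pairwiseSum-≤-potential boundary (prefixCode p) (offLength p)
         (prefixCode-≤ p) (boundary-step p) sorted ⟩
  σ ^ p + 2 * sum (map (offLength p) R)
    ≡⟨ cong (λ n → σ ^ p + 2 * n) (sum-↭ (↭-map⁺ (offLength p) R↭rotations)) ⟩
  σ ^ p + 2 * sum (map (offLength p) (allRotations (blocks p q w)))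
    ≤⟨ +-monoʳ-≤ (σ ^ p) (*-monoʳ-≤ 2 (offLength-blocks p q ∣w∣)) ⟩
  σ ^ p + 2 * (p + r)
    ∎
  where
    open ≤-Reasoning
    long : All (λ v → p ≤ length v) (allRotations (blocks p q w))
    long = allRotations-long p (blocks-long p q ∣w∣)
    nonempty : ∀ {v : Word σ} → p ≤ length v → v ≢ []
    nonempty p≤∣v∣ refl = <-irrefl refl (≤-trans 1≤p p≤∣v∣)
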